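{- Let $g$ be a non-empty list of natural numbers with $0$ not occurring in $g$, and let $M$ be the submonoid of $(\mathbb{N},+)$ generated by the elements of $g$. Let $k \in \mathbb{N}$ and let $x \in M$ with $x < |\mathrm{lgen}_{|g|-1}(k)| \cdot \min g$. Then there exists $n < k$ such that $\mathrm{mgen}_g(n) = x$.
   Context: For $m \in \mathbb{N}$, $\mathrm{next}_m$ on lists of naturals is defined by: $\mathrm{next}_m([\,]) = [0]$; $\mathrm{next}_m(h :: t) = (h+1) :: t$ if $h < m$; if $h \ge m$: $\mathrm{next}_m(h :: t) = [\,]$ when $\mathrm{next}_m(t) = [\,]$, and $=x :: x :: t'$ when $\mathrm{next}_m(t) = x :: t'$. $\mathrm{lgen}_m(0) = [\,]$, $\mathrm{lgen}_m(x+1) = \mathrm{next}_m(\mathrm{lgen}_m(x))$. For a list $g$, $g[i]$ is its $i$-th element (indexing from $0$), $|g|$ its length, and $\min g$ its minimum element. Define $\mathrm{mgen}_g(n) = \sum_{i \in \mathrm{lgen}_{|g|-1}(n)} g[i]$, the sum running over the elements of the list $\mathrm{lgen}_{|g|-1}(n)$ with multiplicity. -}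

module Defs where

open import Data.Nat using (ℕ; zero; suc; _+_; _<?_; _∸_; _⊓_)
open import Data.List using (List; []; _∷_; length; map; foldr)
open import Data.Nat.ListAction using (sum)
open import Data.List.Membership.Propositional using (_∈_)
open import Relation.Nullary using (yes; no)

next : ℕ → List ℕ → List ℕ
next m [] = 0 ∷ []
next m (h ∷ t) with h <? m
... | yes _ = suc h ∷ t
... | no _ with next m t
...   | [] = []
...   | x ∷ t' = x ∷ x ∷ t'

lgen : ℕ → ℕ → List ℕ
lgen m zero = []
lgen m (suc x) = next m (lgen m x)

-- g[i], i-th element (0-indexed); out-of-range default 0 (never used:
-- all entries of lgen_{|g|-1} are ≤ |g|-1)
nth : List ℕ → ℕ → ℕ
nth [] _ = 0
nth (a ∷ _) zero = a
nth (_ ∷ as) (suc i) = nth as i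

minList : List ℕ → ℕ
minList [] = 0
minList (h ∷ t) = foldr _⊓_ h t

mgen : List ℕ → ℕ → ℕ
mgen g n = sum (map (nth g) (lgen (length g ∸ 1) n))

data InMonoid (g : List ℕ) : ℕ → Set where
  zero∈ : InMonoid g 0
  gen+ : ∀ {a x} → a ∈ g → InMonoid g x → InMonoid g (a + x)

{-# OPTIONS --safe #-}
-- Write x as Σ_{i ∈ s} g[i] for a list s of indices sorted non-increasingly. With m = |g| - 1,
-- the lists lgen_m(n) run through all non-increasing lists with entries ≤ m, and their lengths
-- weakly increase with n. So s = lgen_m(n) for some n, and |s| · min g ≤ x < |lgen_m(k)| · min g
-- gives |lgen_m(n)| < |lgen_m(k)|, hence n < k.
module Submission where

open import Defs
open import Data.Nat using (ℕ; zero; suc; _*_; _∸_; _⊓_; _≤_; _<_; _≥_; _≤′_; _<?_; z≤n; s≤s; ≤′-refl; ≤′-step)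
open import Data.Nat.Properties
  using (≤-refl; ≤-trans; <⇒≤; <⇒≤pred; n≮n; ≤⇒≤′; ≰⇒>; <⇒≱; ≤-<-trans; +-mono-≤; *-cancelʳ-<;
         m≤n⇒m⊓o≤n; m≤n⇒o⊓m≤n; ≤-decTotalOrder)
open import Data.Nat.ListAction using (sum)
open import Data.Nat.ListAction.Properties using (sum-↭)
open import Data.List using (List; []; _∷_; length; map; head)
open import Data.List.Properties using (foldr-preservesᵒ)
open import Data.List.Membership.Propositional using (_∈_; _∉_)
open import Data.List.Relation.Unary.All as All using (All; []; _∷_)
open import Data.List.Relation.Unary.Any using (Any; here; there)
import Data.List.Relation.Unary.Any as Any
open import Data.List.Relation.Unary.Linked using (Linked; []; head′) renaming (tail to Linked-tail)
open import Data.List.Relation.Binary.Permutation.Propositional using (↭-sym)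
open import Data.List.Relation.Binary.Permutation.Propositional.Properties using (↭-length; All-resp-↭; map⁺)
open import Data.Maybe using (just)
open import Data.Maybe.Relation.Binary.Connected using (Connected; just; just-nothing)
open import Data.Product using (Σ; ∃-syntax; _×_; _,_)
open import Data.Sum using (_⊎_; inj₁; inj₂)
open import Relation.Binary.Properties.DecTotalOrder ≤-decTotalOrder using (≥-decTotalOrder)
open import Data.List.Sort ≥-decTotalOrder using (sort; sort-↭; sort-↗)
open import Relation.Nullary using (yes; no; contradiction)
open import Relation.Binary.PropositionalEquality using (_≡_; _≢_; refl; sym; trans; subst)

private
  variable
    m n k h x : ℕ
    t t′ : List ℕ

next-< : h < m → next m (h ∷ t) ≡ suc h ∷ t
next-< {h} {m} h<m with h <? m
... | yes _ = refl
... | no h≮m = contradiction h<m h≮m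

next-nonempty : ∀ m t → ∃[ x ] ∃[ t′ ] next m t ≡ x ∷ t′
next-nonempty m [] = 0 , [] , refl
next-nonempty m (h ∷ t) with h <? m
... | yes _ = suc h , t , refl
... | no _ with next m t | next-nonempty m t
...   | x ∷ t′ | _ = x , x ∷ t′ , refl

next-max : next m t ≡ x ∷ t′ → next m (m ∷ t) ≡ x ∷ x ∷ t′
next-max {m} eq with m <? m
... | yes m<m = contradiction m<m (n≮n m)
... | no _ rewrite eq = refl

head-next-≤ : ∀ m t → Connected _≥_ (just m) (head (next m t))
head-next-≤ m [] = just z≤n
head-next-≤ m (h ∷ t) with h <? m
... | yes h<m = just h<m
... | no _ with next m t | head-next-≤ m t
...   | [] | _ = just-nothing
...   | x ∷ _ | just x≤m = just x≤m

length-next : ∀ m t → length t ≤ length (next m t)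
length-next m [] = z≤n
length-next m (h ∷ t) with h <? m
... | yes _ = ≤-refl
... | no _ with next m t | length-next m t | next-nonempty m t
...   | x ∷ t′ | |t|≤ | _ = s≤s |t|≤

head-lgen-≤ : ∀ m n → Connected _≥_ (just m) (head (lgen m n))
head-lgen-≤ m zero = just-nothing
head-lgen-≤ m (suc n) = head-next-≤ m (lgen m n)

length-lgen-mono : n ≤′ k → length (lgen m n) ≤ length (lgen m k)
length-lgen-mono ≤′-refl = ≤-refl
length-lgen-mono {m = m} (≤′-step {k} n≤′k) =
  ≤-trans (length-lgen-mono n≤′k) (length-next m (lgen m k))

length-lgen-<⇒< : length (lgen m n) < length (lgen m k) → n < k
length-lgen-<⇒< |lgen-n|<|lgen-k| =
  ≰⇒> λ k≤n → <⇒≱ |lgen-n|<|lgen-k| (length-lgen-mono (≤⇒≤′ k≤n))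

Reachable : ℕ → List ℕ → Set
Reachable m s = ∃[ n ] lgen m n ≡ s

reachable-next : Reachable m t → Reachable m (next m t)
reachable-next (n , refl) = suc n , refl

reachable-climb : x ≤′ h → h ≤ m → Reachable m (x ∷ t) → Reachable m (h ∷ t)
reachable-climb ≤′-refl _ r = r
reachable-climb (≤′-step x≤′h) h<m r
  with n , eq ← reachable-next (reachable-climb x≤′h (<⇒≤ h<m) r) = n , trans eq (next-< h<m)

-- If lgen_m(n + 1) = x ∷ t′, the successor of the reachable list m ∷ lgen_m(n) is x ∷ lgen_m(n + 1),
-- from which h ∷ lgen_m(n + 1) is reached by raising the head x to h.
reachable-cons : ∀ n → h ≤ m → Connected _≥_ (just h) (head (lgen m n)) → Reachable m (h ∷ lgen m n)
reachable-cons zero h≤m _ = reachable-climb (≤⇒≤′ z≤n) h≤m (1 , refl)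
reachable-cons {h} {m} (suc n) h≤m h≥head
  with x , t′ , eq ← next-nonempty m (lgen m n) | reachable-cons n ≤-refl (head-lgen-≤ m n)
... | r rewrite eq with just x≤h ← h≥head =
  reachable-climb (≤⇒≤′ x≤h) h≤m (subst (Reachable m) (next-max {m} {lgen m n} eq) (reachable-next r))

lgen-surjective : ∀ {s} → All (_≤ m) s → Linked _≥_ s → Reachable m s
lgen-surjective [] [] = 0 , refl
lgen-surjective (h≤m ∷ s≤m) s↘ with n , refl ← lgen-surjective s≤m (Linked-tail s↘) =
  reachable-cons n h≤m (head′ s↘)

indexSum : List ℕ → List ℕ → ℕ
indexSum g s = sum (map (nth g) s)

nth-∈ : ∀ g {i} → i < length g → nth g i ∈ g
nth-∈ (a ∷ g) {zero} _ = here refl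
nth-∈ (a ∷ g) {suc i} (s≤s i<|g|) = there (nth-∈ g i<|g|)

∈⇒nth : ∀ {g a} → a ∈ g → ∃[ i ] i < length g × nth g i ≡ a
∈⇒nth (here refl) = 0 , s≤s z≤n , refl
∈⇒nth (there a∈g) with i , i<|g| , eq ← ∈⇒nth a∈g = suc i , s≤s i<|g| , eq

minList-≤ : ∀ {g a} → a ∈ g → minList g ≤ a
minList-≤ {h ∷ t} {a} a∈g = foldr-preservesᵒ ⊓-pres h t (≤a-somewhere a∈g)
  where
    ⊓-pres : ∀ y z → y ≤ a ⊎ z ≤ a → y ⊓ z ≤ a
    ⊓-pres y z (inj₁ y≤a) = m≤n⇒m⊓o≤n z y≤a
    ⊓-pres y z (inj₂ z≤a) = m≤n⇒o⊓m≤n y z≤a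
    ≤a-somewhere : a ∈ h ∷ t → h ≤ a ⊎ Any (_≤ a) t
    ≤a-somewhere (here refl) = inj₁ ≤-refl
    ≤a-somewhere (there a∈t) = inj₂ (Any.map (λ { refl → ≤-refl }) a∈t)

length*minList≤indexSum : ∀ g {s} → All (_< length g) s → length s * minList g ≤ indexSum g s
length*minList≤indexSum g [] = z≤n
length*minList≤indexSum g (i<|g| ∷ s<|g|) =
  +-mono-≤ (minList-≤ (nth-∈ g i<|g|)) (length*minList≤indexSum g s<|g|)

inMonoid⇒indices : ∀ {g x} → InMonoid g x → ∃[ s ] All (_< length g) s × indexSum g s ≡ x
inMonoid⇒indices zero∈ = [] , [] , refl
inMonoid⇒indices (gen+ a∈g x∈M)
  with s , s<|g| , refl ← inMonoid⇒indices x∈M | i , i<|g| , refl ← ∈⇒nth a∈g =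
  i ∷ s , i<|g| ∷ s<|g| , refl

inMonoid⇒sortedIndices : ∀ {g x} → InMonoid g x →
  ∃[ s ] Linked _≥_ s × All (_≤ length g ∸ 1) s × indexSum g s ≡ x × length s * minList g ≤ x
inMonoid⇒sortedIndices {g} x∈M with s , s<|g| , refl ← inMonoid⇒indices x∈M =
  sort s , sort-↗ s , All.map <⇒≤pred (All-resp-↭ (↭-sym (sort-↭ s)) s<|g|) ,
  sum-↭ (map⁺ (nth g) (sort-↭ s)) ,
  subst (λ l → l * minList g ≤ indexSum g s) (sym (↭-length (sort-↭ s))) (length*minList≤indexSum g s<|g|)

theorem9 : (g : List ℕ) → g ≢ [] → 0 ∉ g → (k x : ℕ) → InMonoid g x → x < length (lgen (length g ∸ 1) k) * minList g → Σ ℕ (λ n → n < k × mgen g n ≡ x)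
theorem9 g _ _ k x x∈M x<bound
  with s , s↘ , s≤m , sum≡x , |s|*min≤x ← inMonoid⇒sortedIndices x∈M
  with n , refl ← lgen-surjective s≤m s↘ =
  n , length-lgen-<⇒< (*-cancelʳ-< _ _ _ (≤-<-trans |s|*min≤x x<bound)) , sum≡x
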